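{- For every integer $n\geq 0$, $$\sum_{k=0}^{n}(-1)^{k}\binom{2n+1}{2k}2^{2n-2k}T_{2k+1}=(-1)^nT_{2n+1}.$$
   Context: The tangent numbers $T_{2k+1}$ are defined by $\tan(x)=\sum_{k\geq0}T_{2k+1}\frac{x^{2k+1}}{(2k+1)!}$ (so $T_1=1,T_3=2,T_5=16,T_7=272,\dots$). -}

module Defs where

open import Data.Nat using (ℕ; zero; suc; _+_; _*_; _∸_; _^_)
open import Data.Nat.Combinatorics using (_C_)
open import Data.List using (List; []; _∷_; _∷ʳ_; length; reverse; zipWith; upTo; map)
open import Data.Nat.ListAction using (sum)
open import Data.Fin using (Fin)
open import Data.Integer as ℤ using (ℤ; +_)

-- Taylor coefficients of tan as a formal power series (exponential
-- generating function):  tan x = Σ_m a m · x^m / m!.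
-- tan is the unique formal power series with t(0) = 0 and t' = 1 + t²,
-- which on coefficients reads
--   a 0 = 0,
--   a (m+1) = [m = 0] + Σ_{i=0}^{m} C(m,i) · a i · a (m-i).
-- tanCoeffsUpTo m = [a 0, …, a (m-1)]  (defined by structural recursion).

private
  step : List ℕ → ℕ
  step as = delta + sum (zipWith (λ i x → i * x) binoms (zipWith _*_ as (reverse as)))
    where
    m : ℕ
    m = length as ∸ 1
    delta : ℕ
    delta with m
    ... | zero = 1
    ... | suc _ = 0
    binoms : List ℕ
    binoms = map (λ i → m C i) (upTo (suc m))

tanCoeffsUpTo : ℕ → List ℕ
tanCoeffsUpTo zero = []
tanCoeffsUpTo (suc zero) = 0 ∷ []
tanCoeffsUpTo (suc (suc m)) = let as = tanCoeffsUpTo (suc m) in as ∷ʳ step as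

tanCoeff : ℕ → ℕ
tanCoeff m = lastOr (tanCoeffsUpTo (suc m))
  where
  lastOr : List ℕ → ℕ
  lastOr [] = 0
  lastOr (x ∷ []) = x
  lastOr (_ ∷ y ∷ ys) = lastOr (y ∷ ys)

T : ℕ → ℕ
T k = tanCoeff (suc (2 * k))

sgn : ℕ → ℤ
sgn zero = + 1
sgn (suc k) = ℤ.- sgn k

sumTo : ℕ → (ℕ → ℤ) → ℤ
sumTo zero f = f 0
sumTo (suc n) f = sumTo n f ℤ.+ f (suc n)

-- On exponential generating functions tan = tan′ · ½ sin 2x, because
-- tan′ = sec² and sin 2x = 2 sin x cos x. As ½ sin 2x is odd with
-- coefficients (-4)^j, comparing coefficients of x^(2n+1)/(2n+1)! gives
--   T_{2n+1} = Σ_k C(2n+1,2k) T_{2k+1} (-1)^(n-k) 4^(n-k),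
-- which is the claim multiplied by (-1)^n.
-- The identity tan = tan′ · s, where s = ½ sin 2x and c = cos 2x, is a
-- uniqueness statement for a linear system: P = tan′ s − tan,
-- Q = 2 tan s + c − 1 and R = tan + tan c − 2s vanish at 0 and satisfy
-- P′ = tan′ Q, Q′ = 2P + 2R and R′ = tan R − Q, so they vanish identically.
module Submission where

open import Defs
open import Data.Nat using (ℕ; _+_; _*_; _∸_; _^_)
open import Data.Nat.Combinatorics using (_C_)
open import Data.Integer using (ℤ; +_) renaming (_*_ to _*ℤ_)
open import Relation.Binary.PropositionalEquality using (_≡_)

open import Data.Nat using (zero; suc; _≤_; z≤n; s≤s)
import Data.Nat.Properties as ℕ
open import Data.Nat.Combinatorics using (k>n⇒nCk≡0; nCk+nC[k+1]≡[n+1]C[k+1])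
open import Data.Nat.ListAction using (sum)
open import Data.List using (List; []; _∷_; _∷ʳ_; length; reverse; zipWith; map; upTo; applyUpTo; applyDownFrom)
open import Data.List.Properties using (applyUpTo-∷ʳ; length-applyUpTo; map-upTo; reverse-applyUpTo)
open import Data.Integer using (-_; _-_) renaming (_+_ to _+ℤ_)
import Data.Integer.Properties as ℤ
open import Data.Integer.Tactic.RingSolver using (solve-∀)
import Algebra.Properties.CommutativeSemigroup as CommSemigroupProperties
open import Data.Product using (_×_; _,_; proj₁)
open import Data.Sum using (inj₁; inj₂)
open import Relation.Binary.PropositionalEquality using (_≗_; refl; sym; trans; cong; cong₂; module ≡-Reasoning)
open ≡-Reasoning

module +ℤ = CommSemigroupProperties ℤ.+-commutativeSemigroup

private
  variable
    m n k : ℕ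

Seq : Set
Seq = ℕ → ℤ

D : Seq → Seq
D f m = f (suc m)

δ₀ : ℕ → ℕ
δ₀ zero = 1
δ₀ (suc _) = 0

one : Seq
one m = + δ₀ m

infixl 6 _⊕_ _⊖_
infixr 7 _·_
infixl 8 _⋆_

_⊕_ _⊖_ : Seq → Seq → Seq
(f ⊕ g) m = f m +ℤ g m
(f ⊖ g) m = f m - g m

_·_ : ℤ → Seq → Seq
(c · f) m = c *ℤ f m

-- The product of exponential generating functions, defined by the Leibniz
-- rule; ⋆-binomial identifies it with the binomial convolution.
_⋆_ : Seq → Seq → Seq
(f ⋆ g) zero = f 0 *ℤ g 0
(f ⋆ g) (suc m) = (D f ⋆ g) m +ℤ (f ⋆ D g) m

VanishesUpTo : ℕ → Seq → Set
VanishesUpTo m f = ∀ i → i ≤ m → f i ≡ + 0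

sumTo-cong : ∀ n {f g : Seq} → (∀ i → i ≤ n → f i ≡ g i) → sumTo n f ≡ sumTo n g
sumTo-cong zero f≡g = f≡g 0 z≤n
sumTo-cong (suc n) f≡g =
  cong₂ _+ℤ_ (sumTo-cong n (λ i i≤n → f≡g i (ℕ.m≤n⇒m≤1+n i≤n))) (f≡g (suc n) ℕ.≤-refl)

sumTo-sucˡ : ∀ n (f : Seq) → sumTo (suc n) f ≡ f 0 +ℤ sumTo n (D f)
sumTo-sucˡ zero f = refl
sumTo-sucˡ (suc n) f = trans (cong (_+ℤ f (suc (suc n))) (sumTo-sucˡ n f)) (ℤ.+-assoc (f 0) _ _)

sumTo-⊕ : ∀ n (f g : Seq) → sumTo n (f ⊕ g) ≡ sumTo n f +ℤ sumTo n g
sumTo-⊕ zero f g = refl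
sumTo-⊕ (suc n) f g = trans (cong (_+ℤ (f ⊕ g) (suc n)) (sumTo-⊕ n f g)) (+ℤ.interchange (sumTo n f) (sumTo n g) (f (suc n)) (g (suc n)))

sumTo-· : ∀ n c (f : Seq) → sumTo n (c · f) ≡ c *ℤ sumTo n f
sumTo-· zero c f = refl
sumTo-· (suc n) c f = trans (cong (_+ℤ c *ℤ f (suc n)) (sumTo-· n c f)) (sym (ℤ.*-distribˡ-+ c _ _))

sumTo-pairs : ∀ n (f : Seq) → sumTo (suc (2 * n)) f ≡ sumTo n (λ k → f (2 * k) +ℤ f (suc (2 * k)))
sumTo-pairs zero f = refl
sumTo-pairs (suc n) f = begin
    sumTo (suc (2 * suc n)) f
  ≡⟨ cong (λ j → sumTo (suc j) f) (ℕ.*-suc 2 n) ⟩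
    sumTo (suc (2 * n)) f +ℤ f (2 + 2 * n) +ℤ f (3 + 2 * n)
  ≡⟨ ℤ.+-assoc (sumTo (suc (2 * n)) f) (f (2 + 2 * n)) (f (3 + 2 * n)) ⟩
    sumTo (suc (2 * n)) f +ℤ (f (2 + 2 * n) +ℤ f (3 + 2 * n))
  ≡⟨ cong₂ _+ℤ_ (sumTo-pairs n f) (cong (λ j → f j +ℤ f (suc j)) (sym (ℕ.*-suc 2 n))) ⟩
    sumTo (suc n) (λ k → f (2 * k) +ℤ f (suc (2 * k))) ∎

⋆-cong : ∀ {f f′ g g′} → f ≗ f′ → g ≗ g′ → f ⋆ g ≗ f′ ⋆ g′
⋆-cong f≗f′ g≗g′ zero = cong₂ _*ℤ_ (f≗f′ 0) (g≗g′ 0)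
⋆-cong f≗f′ g≗g′ (suc m) =
  cong₂ _+ℤ_ (⋆-cong (λ i → f≗f′ (suc i)) g≗g′ m) (⋆-cong f≗f′ (λ i → g≗g′ (suc i)) m)

⋆-comm : ∀ f g → f ⋆ g ≗ g ⋆ f
⋆-comm f g zero = ℤ.*-comm (f 0) (g 0)
⋆-comm f g (suc m) = trans (cong₂ _+ℤ_ (⋆-comm (D f) g m) (⋆-comm f (D g) m)) (ℤ.+-comm ((g ⋆ D f) m) ((D g ⋆ f) m))

⋆-distribˡ-⊕ : ∀ f g h → f ⋆ (g ⊕ h) ≗ f ⋆ g ⊕ f ⋆ h
⋆-distribˡ-⊕ f g h zero = ℤ.*-distribˡ-+ (f 0) (g 0) (h 0)
⋆-distribˡ-⊕ f g h (suc m) =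
  trans (cong₂ _+ℤ_ (⋆-distribˡ-⊕ (D f) g h m) (⋆-distribˡ-⊕ f (D g) (D h) m))
        (+ℤ.interchange ((D f ⋆ g) m) ((D f ⋆ h) m) ((f ⋆ D g) m) ((f ⋆ D h) m))

⋆-distribʳ-⊕ : ∀ f g h → (f ⊕ g) ⋆ h ≗ f ⋆ h ⊕ g ⋆ h
⋆-distribʳ-⊕ f g h m =
  trans (⋆-comm (f ⊕ g) h m) (trans (⋆-distribˡ-⊕ h f g m) (cong₂ _+ℤ_ (⋆-comm h f m) (⋆-comm h g m)))

⋆-distribˡ-⊖ : ∀ f g h → f ⋆ (g ⊖ h) ≗ f ⋆ g ⊖ f ⋆ h
⋆-distribˡ-⊖ f g h zero = distrib (f 0) (g 0) (h 0)
  where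
  distrib : ∀ a b c → a *ℤ (b - c) ≡ a *ℤ b - a *ℤ c
  distrib = solve-∀
⋆-distribˡ-⊖ f g h (suc m) =
  trans (cong₂ _+ℤ_ (⋆-distribˡ-⊖ (D f) g h m) (⋆-distribˡ-⊖ f (D g) (D h) m))
        (interchange ((D f ⋆ g) m) ((D f ⋆ h) m) ((f ⋆ D g) m) ((f ⋆ D h) m))
  where
  interchange : ∀ a b c d → (a - b) +ℤ (c - d) ≡ (a +ℤ c) - (b +ℤ d)
  interchange = solve-∀

⋆-·ʳ : ∀ c f g → f ⋆ (c · g) ≗ c · (f ⋆ g)
⋆-·ʳ c f g zero = swap (f 0) c (g 0)
  where
  swap : ∀ x c y → x *ℤ (c *ℤ y) ≡ c *ℤ (x *ℤ y)
  swap = solve-∀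
⋆-·ʳ c f g (suc m) =
  trans (cong₂ _+ℤ_ (⋆-·ʳ c (D f) g m) (⋆-·ʳ c f (D g) m)) (sym (ℤ.*-distribˡ-+ c _ _))

⋆-·ˡ : ∀ c f g → (c · f) ⋆ g ≗ c · (f ⋆ g)
⋆-·ˡ c f g m = trans (⋆-comm (c · f) g m) (trans (⋆-·ʳ c g f m) (cong (c *ℤ_) (⋆-comm g f m)))

⋆-assoc : ∀ f g h → (f ⋆ g) ⋆ h ≗ f ⋆ (g ⋆ h)
⋆-assoc f g h zero = ℤ.*-assoc (f 0) (g 0) (h 0)
⋆-assoc f g h (suc m) = begin
    (D (f ⋆ g) ⋆ h) m +ℤ ((f ⋆ g) ⋆ D h) m
  ≡⟨ cong (_+ℤ ((f ⋆ g) ⋆ D h) m) (⋆-distribʳ-⊕ (D f ⋆ g) (f ⋆ D g) h m) ⟩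
    ((D f ⋆ g) ⋆ h) m +ℤ ((f ⋆ D g) ⋆ h) m +ℤ ((f ⋆ g) ⋆ D h) m
  ≡⟨ cong₂ _+ℤ_ (cong₂ _+ℤ_ (⋆-assoc (D f) g h m) (⋆-assoc f (D g) h m)) (⋆-assoc f g (D h) m) ⟩
    (D f ⋆ (g ⋆ h)) m +ℤ (f ⋆ (D g ⋆ h)) m +ℤ (f ⋆ (g ⋆ D h)) m
  ≡⟨ ℤ.+-assoc ((D f ⋆ (g ⋆ h)) m) ((f ⋆ (D g ⋆ h)) m) ((f ⋆ (g ⋆ D h)) m) ⟩
    (D f ⋆ (g ⋆ h)) m +ℤ ((f ⋆ (D g ⋆ h)) m +ℤ (f ⋆ (g ⋆ D h)) m)
  ≡⟨ cong ((D f ⋆ (g ⋆ h)) m +ℤ_) (sym (⋆-distribˡ-⊕ f (D g ⋆ h) (g ⋆ D h) m)) ⟩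
    (D f ⋆ (g ⋆ h)) m +ℤ (f ⋆ D (g ⋆ h)) m ∎

⋆-zeroʳ : ∀ f g m → VanishesUpTo m g → (f ⋆ g) m ≡ + 0
⋆-zeroʳ f g zero g≡0 = trans (cong (f 0 *ℤ_) (g≡0 0 z≤n)) (ℤ.*-zeroʳ (f 0))
⋆-zeroʳ f g (suc m) g≡0 = cong₂ _+ℤ_
  (⋆-zeroʳ (D f) g m (λ i i≤m → g≡0 i (ℕ.m≤n⇒m≤1+n i≤m)))
  (⋆-zeroʳ f (D g) m (λ i i≤m → g≡0 (suc i) (s≤s i≤m)))

⋆-identityʳ : ∀ f → f ⋆ one ≗ f
⋆-identityʳ f zero = ℤ.*-identityʳ (f 0)
⋆-identityʳ f (suc m) =
  trans (cong₂ _+ℤ_ (⋆-identityʳ (D f) m) (⋆-zeroʳ f (D one) m (λ _ _ → refl))) (ℤ.+-identityʳ _)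

⋆-identityˡ : ∀ f → one ⋆ f ≗ f
⋆-identityˡ f m = trans (⋆-comm one f m) (⋆-identityʳ f m)

binomialSum : Seq → Seq → Seq
binomialSum f g m = sumTo m (λ i → + (m C i) *ℤ (f i *ℤ g (m ∸ i)))

binomialSum-leibniz : ∀ f g m → binomialSum f g (suc m) ≡ binomialSum (D f) g m +ℤ binomialSum f (D g) m
binomialSum-leibniz f g m = begin
    sumTo (suc m) (term (suc m))
  ≡⟨ sumTo-sucˡ m (term (suc m)) ⟩
    term m 0 +ℤ sumTo m (D (term (suc m)))
  ≡⟨ cong (term m 0 +ℤ_) (trans (sumTo-cong m (λ j _ → pascal j)) (sumTo-⊕ m _ _)) ⟩
    term m 0 +ℤ (binomialSum (D f) g m +ℤ sumTo m (D (term m)))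
  ≡⟨ +ℤ.x∙yz≈y∙xz (term m 0) (binomialSum (D f) g m) (sumTo m (D (term m))) ⟩
    binomialSum (D f) g m +ℤ (term m 0 +ℤ sumTo m (D (term m)))
  ≡⟨ cong (binomialSum (D f) g m +ℤ_) (sym (sumTo-sucˡ m (term m))) ⟩
    binomialSum (D f) g m +ℤ (sumTo m (term m) +ℤ term m (suc m))
  ≡⟨ cong (binomialSum (D f) g m +ℤ_) (trans (cong (sumTo m (term m) +ℤ_) last≡0) (ℤ.+-identityʳ _)) ⟩
    binomialSum (D f) g m +ℤ sumTo m (term m)
  ≡⟨ cong (binomialSum (D f) g m +ℤ_) (sumTo-cong m (λ i i≤m → cong (λ j → term′ i j) (ℕ.+-∸-assoc 1 i≤m))) ⟩
    binomialSum (D f) g m +ℤ binomialSum f (D g) m ∎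
  where
  X : Seq
  X i = f i *ℤ g (suc m ∸ i)

  term : ℕ → Seq
  term k i = + (k C i) *ℤ X i

  term′ : ℕ → ℕ → ℤ
  term′ i j = + (m C i) *ℤ (f i *ℤ g j)

  pascal : ∀ j → term (suc m) (suc j) ≡ + (m C j) *ℤ X (suc j) +ℤ term m (suc j)
  pascal j = begin
      + (suc m C suc j) *ℤ X (suc j)
    ≡⟨ cong (λ c → + c *ℤ X (suc j)) (sym (nCk+nC[k+1]≡[n+1]C[k+1] m j)) ⟩
      + (m C j + m C suc j) *ℤ X (suc j)
    ≡⟨ cong (_*ℤ X (suc j)) (ℤ.pos-+ (m C j) _) ⟩
      (+ (m C j) +ℤ + (m C suc j)) *ℤ X (suc j)
    ≡⟨ ℤ.*-distribʳ-+ (X (suc j)) (+ (m C j)) (+ (m C suc j)) ⟩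
      + (m C j) *ℤ X (suc j) +ℤ term m (suc j) ∎

  last≡0 : term m (suc m) ≡ + 0
  last≡0 = trans (cong (λ c → + c *ℤ X (suc m)) (k>n⇒nCk≡0 (ℕ.n<1+n m))) (ℤ.*-zeroˡ (X (suc m)))

⋆-binomial : ∀ f g → f ⋆ g ≗ binomialSum f g
⋆-binomial f g zero = sym (ℤ.*-identityˡ (f 0 *ℤ g 0))
⋆-binomial f g (suc m) =
  trans (cong₂ _+ℤ_ (⋆-binomial (D f) g m) (⋆-binomial f (D g) m)) (sym (binomialSum-leibniz f g m))

applyDownFrom-applyUpTo : ∀ {A : Set} (f : ℕ → A) n → applyDownFrom f n ≡ applyUpTo (λ i → f (n ∸ suc i)) n
applyDownFrom-applyUpTo f zero = refl
applyDownFrom-applyUpTo f (suc n) = cong (f n ∷_) (applyDownFrom-applyUpTo f n)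

zipWith-applyUpTo : ∀ {A B Z : Set} (h : A → B → Z) f g n →
                    zipWith h (applyUpTo f n) (applyUpTo g n) ≡ applyUpTo (λ i → h (f i) (g i)) n
zipWith-applyUpTo h f g zero = refl
zipWith-applyUpTo h f g (suc n) = cong (h (f 0) (g 0) ∷_) (zipWith-applyUpTo h (λ i → f (suc i)) (λ i → g (suc i)) n)

sum-applyUpTo : ∀ (f : ℕ → ℕ) m → + sum (applyUpTo f (suc m)) ≡ sumTo m (λ i → + f i)
sum-applyUpTo f zero = cong +_ (ℕ.+-identityʳ (f 0))
sum-applyUpTo f (suc m) = begin
    + (f 0 + sum (applyUpTo (λ i → f (suc i)) (suc m)))
  ≡⟨ ℤ.pos-+ (f 0) _ ⟩
    + f 0 +ℤ + sum (applyUpTo (λ i → f (suc i)) (suc m))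
  ≡⟨ cong (+ f 0 +ℤ_) (sum-applyUpTo (λ i → f (suc i)) m) ⟩
    + f 0 +ℤ sumTo m (λ i → + f (suc i))
  ≡⟨ sym (sumTo-sucˡ m (λ i → + f i)) ⟩
    sumTo (suc m) (λ i → + f i) ∎

-- tanCoeff reads the last entry of a list through a helper bound in a
-- where-clause of Defs; the meta lastEntry is solved against that helper by
-- the proof of tanCoeff-lastEntry, which gives the helper a name.
mutual
  lastEntry : ℕ → List ℕ → ℕ
  lastEntry = _

  tanCoeff-lastEntry : ∀ m → tanCoeff m ≡ lastEntry m (tanCoeffsUpTo (suc m))
  tanCoeff-lastEntry m with tanCoeffsUpTo (suc m)
  ... | as = refl

lastEntry-∷ʳ : ∀ m as a → lastEntry m (as ∷ʳ a) ≡ a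
lastEntry-∷ʳ m [] a = refl
lastEntry-∷ʳ m (_ ∷ []) a = refl
lastEntry-∷ʳ m (_ ∷ b ∷ as) a = lastEntry-∷ʳ m (b ∷ as) a

-- The private step function of Defs, with m = length as ∸ 1.
tanStep : ℕ → List ℕ → ℕ
tanStep m as = δ₀ m + sum (zipWith (λ i x → i * x) (map (λ i → m C i) (upTo (suc m))) (zipWith _*_ as (reverse as)))

-- On lists of length at least 2, m = length ∸ 1 is a successor, so the case
-- distinction on m inside step computes.
tanCoeff-step : ∀ m → tanCoeff (suc m) ≡ tanStep (length (tanCoeffsUpTo (suc m)) ∸ 1) (tanCoeffsUpTo (suc m))
tanCoeff-step m with tanCoeffsUpTo (suc m)
... | [] = refl
... | _ ∷ [] = refl
... | as@(_ ∷ _ ∷ _) = lastEntry-∷ʳ (suc m) as _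

tanCoeffsUpTo-applyUpTo : ∀ m → tanCoeffsUpTo (suc m) ≡ applyUpTo tanCoeff (suc m)
tanCoeffsUpTo-applyUpTo zero = refl
tanCoeffsUpTo-applyUpTo (suc m) = trans
  (cong₂ _∷ʳ_ (tanCoeffsUpTo-applyUpTo m) (sym (lastEntry-∷ʳ (suc m) (tanCoeffsUpTo (suc m)) _)))
  (applyUpTo-∷ʳ tanCoeff (suc m))

tanCoeff-recurrence : ∀ m →
  tanCoeff (suc m) ≡ δ₀ m + sum (applyUpTo (λ i → (m C i) * (tanCoeff i * tanCoeff (m ∸ i))) (suc m))
tanCoeff-recurrence m = begin
    tanCoeff (suc m)
  ≡⟨ tanCoeff-step m ⟩
    tanStep (length (tanCoeffsUpTo (suc m)) ∸ 1) (tanCoeffsUpTo (suc m))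
  ≡⟨ cong (λ as → tanStep (length as ∸ 1) as) (tanCoeffsUpTo-applyUpTo m) ⟩
    tanStep (length as ∸ 1) as
  ≡⟨ cong (λ k → tanStep (k ∸ 1) as) (length-applyUpTo tanCoeff (suc m)) ⟩
    tanStep m as
  ≡⟨ cong (λ xs → δ₀ m + sum xs) products ⟩
    δ₀ m + sum (applyUpTo (λ i → (m C i) * (tanCoeff i * tanCoeff (m ∸ i))) (suc m)) ∎
  where
  as : List ℕ
  as = applyUpTo tanCoeff (suc m)

  products : zipWith (λ i x → i * x) (map (λ i → m C i) (upTo (suc m))) (zipWith _*_ as (reverse as))
           ≡ applyUpTo (λ i → (m C i) * (tanCoeff i * tanCoeff (m ∸ i))) (suc m)
  products = begin
      zipWith (λ i x → i * x) (map (λ i → m C i) (upTo (suc m))) (zipWith _*_ as (reverse as))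
    ≡⟨ cong₂ (zipWith (λ i x → i * x)) (map-upTo (λ i → m C i) (suc m))
             (cong (zipWith _*_ as) (trans (reverse-applyUpTo tanCoeff (suc m)) (applyDownFrom-applyUpTo tanCoeff (suc m)))) ⟩
      zipWith (λ i x → i * x) (applyUpTo (λ i → m C i) (suc m))
              (zipWith _*_ as (applyUpTo (λ i → tanCoeff (m ∸ i)) (suc m)))
    ≡⟨ cong (zipWith (λ i x → i * x) (applyUpTo (λ i → m C i) (suc m))) (zipWith-applyUpTo _*_ tanCoeff (λ i → tanCoeff (m ∸ i)) (suc m)) ⟩
      zipWith (λ i x → i * x) (applyUpTo (λ i → m C i) (suc m))
              (applyUpTo (λ i → tanCoeff i * tanCoeff (m ∸ i)) (suc m))
    ≡⟨ zipWith-applyUpTo (λ i x → i * x) (λ i → m C i) (λ i → tanCoeff i * tanCoeff (m ∸ i)) (suc m) ⟩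
      applyUpTo (λ i → (m C i) * (tanCoeff i * tanCoeff (m ∸ i))) (suc m) ∎

tan : Seq
tan m = + tanCoeff m

tan′≗one⊕tan⋆tan : D tan ≗ one ⊕ tan ⋆ tan
tan′≗one⊕tan⋆tan m = begin
    + tanCoeff (suc m)
  ≡⟨ cong +_ (tanCoeff-recurrence m) ⟩
    + (δ₀ m + sum (applyUpTo (λ i → (m C i) * (tanCoeff i * tanCoeff (m ∸ i))) (suc m)))
  ≡⟨ ℤ.pos-+ (δ₀ m) _ ⟩
    one m +ℤ + sum (applyUpTo (λ i → (m C i) * (tanCoeff i * tanCoeff (m ∸ i))) (suc m))
  ≡⟨ cong (one m +ℤ_) (sum-applyUpTo _ m) ⟩
    one m +ℤ sumTo m (λ i → + ((m C i) * (tanCoeff i * tanCoeff (m ∸ i))))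
  ≡⟨ cong (one m +ℤ_) (sumTo-cong m (λ i _ → pos-*-*  (m C i) (tanCoeff i) (tanCoeff (m ∸ i)))) ⟩
    one m +ℤ binomialSum tan tan m
  ≡⟨ cong (one m +ℤ_) (sym (⋆-binomial tan tan m)) ⟩
    one m +ℤ (tan ⋆ tan) m ∎
  where
  pos-*-* : ∀ a b c → + (a * (b * c)) ≡ + a *ℤ (+ b *ℤ + c)
  pos-*-* a b c = trans (ℤ.pos-* a (b * c)) (cong (+ a *ℤ_) (ℤ.pos-* b c))

-- tan = tan′ · ½ sin 2x

-- sin₂ and cos₂ are the exponential generating functions of ½ sin 2x and cos 2x.
mutual
  sin₂ : Seq
  sin₂ zero = + 0
  sin₂ (suc m) = cos₂ m

  cos₂ : Seq
  cos₂ zero = + 1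
  cos₂ (suc m) = - + 4 *ℤ sin₂ m

tan″≗2·tan′⋆tan : D (D tan) ≗ + 2 · (D tan ⋆ tan)
tan″≗2·tan′⋆tan m = begin
    D tan (suc m)
  ≡⟨ tan′≗one⊕tan⋆tan (suc m) ⟩
    + 0 +ℤ ((D tan ⋆ tan) m +ℤ (tan ⋆ D tan) m)
  ≡⟨ cong (λ x → + 0 +ℤ ((D tan ⋆ tan) m +ℤ x)) (⋆-comm tan (D tan) m) ⟩
    + 0 +ℤ ((D tan ⋆ tan) m +ℤ (D tan ⋆ tan) m)
  ≡⟨ double ((D tan ⋆ tan) m) ⟩
    + 2 *ℤ (D tan ⋆ tan) m ∎
  where
  double : ∀ x → + 0 +ℤ (x +ℤ x) ≡ + 2 *ℤ x
  double = solve-∀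

private
  P Q R : Seq
  P = D tan ⋆ sin₂ ⊖ tan
  Q = + 2 · tan ⋆ sin₂ ⊕ cos₂ ⊖ one
  R = tan ⊕ tan ⋆ cos₂ ⊖ + 2 · sin₂

  P′ : ∀ m → P (suc m) ≡ (D tan ⋆ Q) m
  P′ m = begin
      (D (D tan) ⋆ sin₂) m +ℤ (D tan ⋆ cos₂) m - D tan m
    ≡⟨ cong₂ (λ x y → x +ℤ (D tan ⋆ cos₂) m - y) tan″⋆sin₂ (sym (⋆-identityʳ (D tan) m)) ⟩
      + 2 *ℤ (D tan ⋆ (tan ⋆ sin₂)) m +ℤ (D tan ⋆ cos₂) m - (D tan ⋆ one) m
    ≡⟨ cong (λ x → x +ℤ (D tan ⋆ cos₂) m - (D tan ⋆ one) m) (sym (⋆-·ʳ (+ 2) (D tan) (tan ⋆ sin₂) m)) ⟩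
      (D tan ⋆ (+ 2 · tan ⋆ sin₂)) m +ℤ (D tan ⋆ cos₂) m - (D tan ⋆ one) m
    ≡⟨ cong (_- (D tan ⋆ one) m) (sym (⋆-distribˡ-⊕ (D tan) (+ 2 · tan ⋆ sin₂) cos₂ m)) ⟩
      (D tan ⋆ (+ 2 · tan ⋆ sin₂ ⊕ cos₂)) m - (D tan ⋆ one) m
    ≡⟨ sym (⋆-distribˡ-⊖ (D tan) (+ 2 · tan ⋆ sin₂ ⊕ cos₂) one m) ⟩
      (D tan ⋆ Q) m ∎
    where
    tan″⋆sin₂ : (D (D tan) ⋆ sin₂) m ≡ + 2 *ℤ (D tan ⋆ (tan ⋆ sin₂)) m
    tan″⋆sin₂ = begin
        (D (D tan) ⋆ sin₂) m
      ≡⟨ ⋆-cong tan″≗2·tan′⋆tan (λ _ → refl) m ⟩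
        ((+ 2 · (D tan ⋆ tan)) ⋆ sin₂) m
      ≡⟨ ⋆-·ˡ (+ 2) (D tan ⋆ tan) sin₂ m ⟩
        + 2 *ℤ ((D tan ⋆ tan) ⋆ sin₂) m
      ≡⟨ cong (+ 2 *ℤ_) (⋆-assoc (D tan) tan sin₂ m) ⟩
        + 2 *ℤ (D tan ⋆ (tan ⋆ sin₂)) m ∎

  Q′ : ∀ m → Q (suc m) ≡ + 2 *ℤ P m +ℤ + 2 *ℤ R m
  Q′ m = regroup ((D tan ⋆ sin₂) m) ((tan ⋆ cos₂) m) (sin₂ m) (tan m)
    where
    regroup : ∀ a b s t → + 2 *ℤ (a +ℤ b) +ℤ - + 4 *ℤ s - + 0 ≡ + 2 *ℤ (a - t) +ℤ + 2 *ℤ (t +ℤ b - + 2 *ℤ s)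
    regroup = solve-∀

  R′ : ∀ m → R (suc m) ≡ (tan ⋆ R) m - Q m
  R′ m = begin
      D tan m +ℤ ((D tan ⋆ cos₂) m +ℤ (tan ⋆ D cos₂) m) - + 2 *ℤ cos₂ m
    ≡⟨ cong₂ (λ x y → x +ℤ y - + 2 *ℤ cos₂ m) (tan′≗one⊕tan⋆tan m)
             (cong₂ _+ℤ_ tan′⋆cos₂ (⋆-·ʳ (- + 4) tan sin₂ m)) ⟩
      one m +ℤ (tan ⋆ tan) m +ℤ (cos₂ m +ℤ (tan ⋆ (tan ⋆ cos₂)) m +ℤ - + 4 *ℤ (tan ⋆ sin₂) m) - + 2 *ℤ cos₂ m
    ≡⟨ regroup (one m) ((tan ⋆ tan) m) (cos₂ m) ((tan ⋆ (tan ⋆ cos₂)) m) ((tan ⋆ sin₂) m) ⟩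
      (tan ⋆ tan) m +ℤ (tan ⋆ (tan ⋆ cos₂)) m - + 2 *ℤ (tan ⋆ sin₂) m - Q m
    ≡⟨ cong (_- Q m) (sym tan⋆R) ⟩
      (tan ⋆ R) m - Q m ∎
    where
    tan′⋆cos₂ : (D tan ⋆ cos₂) m ≡ cos₂ m +ℤ (tan ⋆ (tan ⋆ cos₂)) m
    tan′⋆cos₂ = begin
        (D tan ⋆ cos₂) m
      ≡⟨ ⋆-cong tan′≗one⊕tan⋆tan (λ _ → refl) m ⟩
        ((one ⊕ tan ⋆ tan) ⋆ cos₂) m
      ≡⟨ ⋆-distribʳ-⊕ one (tan ⋆ tan) cos₂ m ⟩
        (one ⋆ cos₂) m +ℤ ((tan ⋆ tan) ⋆ cos₂) m
      ≡⟨ cong₂ _+ℤ_ (⋆-identityˡ cos₂ m) (⋆-assoc tan tan cos₂ m) ⟩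
        cos₂ m +ℤ (tan ⋆ (tan ⋆ cos₂)) m ∎

    tan⋆R : (tan ⋆ R) m ≡ (tan ⋆ tan) m +ℤ (tan ⋆ (tan ⋆ cos₂)) m - + 2 *ℤ (tan ⋆ sin₂) m
    tan⋆R = begin
        (tan ⋆ R) m
      ≡⟨ ⋆-distribˡ-⊖ tan (tan ⊕ tan ⋆ cos₂) (+ 2 · sin₂) m ⟩
        (tan ⋆ (tan ⊕ tan ⋆ cos₂)) m - (tan ⋆ (+ 2 · sin₂)) m
      ≡⟨ cong₂ _-_ (⋆-distribˡ-⊕ tan tan (tan ⋆ cos₂) m) (⋆-·ʳ (+ 2) tan sin₂ m) ⟩
        (tan ⋆ tan) m +ℤ (tan ⋆ (tan ⋆ cos₂)) m - + 2 *ℤ (tan ⋆ sin₂) m ∎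

    regroup : ∀ o tt c ttc ts → o +ℤ tt +ℤ (c +ℤ ttc +ℤ - + 4 *ℤ ts) - + 2 *ℤ c
                              ≡ tt +ℤ ttc - + 2 *ℤ ts - (+ 2 *ℤ ts +ℤ c - o)
    regroup = solve-∀

  vanishesUpTo-zero : ∀ {f} → f 0 ≡ + 0 → VanishesUpTo 0 f
  vanishesUpTo-zero f₀≡0 _ z≤n = f₀≡0

  vanishesUpTo-suc : ∀ {f} → VanishesUpTo m f → f (suc m) ≡ + 0 → VanishesUpTo (suc m) f
  vanishesUpTo-suc f≡0 f₁₊ₘ≡0 i i≤1+m with ℕ.m≤n⇒m<n∨m≡n i≤1+m
  ... | inj₁ (s≤s i≤m) = f≡0 i i≤m
  ... | inj₂ refl = f₁₊ₘ≡0

  PQR-vanish : ∀ m → VanishesUpTo m P × VanishesUpTo m Q × VanishesUpTo m R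
  PQR-vanish zero = vanishesUpTo-zero refl , vanishesUpTo-zero refl , vanishesUpTo-zero refl
  PQR-vanish (suc m) with PQR-vanish m
  ... | P≡0 , Q≡0 , R≡0 =
      vanishesUpTo-suc P≡0 (trans (P′ m) (⋆-zeroʳ (D tan) Q m Q≡0))
    , vanishesUpTo-suc Q≡0 (trans (Q′ m) (cong₂ (λ p r → + 2 *ℤ p +ℤ + 2 *ℤ r) (P≡0 m ℕ.≤-refl) (R≡0 m ℕ.≤-refl)))
    , vanishesUpTo-suc R≡0 (trans (R′ m) (cong₂ _-_ (⋆-zeroʳ tan R m R≡0) (Q≡0 m ℕ.≤-refl)))

tan≗tan′⋆sin₂ : tan ≗ D tan ⋆ sin₂
tan≗tan′⋆sin₂ m = sym (ℤ.i-j≡0⇒i≡j _ _ (proj₁ (PQR-vanish m) m ℕ.≤-refl))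

sin₂-even : ∀ j → sin₂ (2 * j) ≡ + 0
sin₂-even zero = refl
sin₂-even (suc j) = trans (cong sin₂ (ℕ.*-suc 2 j)) (cong (- + 4 *ℤ_) (sin₂-even j))

sin₂-odd : ∀ j → sin₂ (suc (2 * j)) ≡ sgn j *ℤ + (4 ^ j)
sin₂-odd zero = refl
sin₂-odd (suc j) = begin
    sin₂ (suc (2 * suc j))
  ≡⟨ cong (λ i → sin₂ (suc i)) (ℕ.*-suc 2 j) ⟩
    - + 4 *ℤ sin₂ (suc (2 * j))
  ≡⟨ cong (- + 4 *ℤ_) (sin₂-odd j) ⟩
    - + 4 *ℤ (sgn j *ℤ + (4 ^ j))
  ≡⟨ regroup (sgn j) (+ (4 ^ j)) ⟩
    - sgn j *ℤ (+ 4 *ℤ + (4 ^ j))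
  ≡⟨ cong (- sgn j *ℤ_) (sym (ℤ.pos-* 4 (4 ^ j))) ⟩
    - sgn j *ℤ + (4 ^ suc j) ∎
  where
  regroup : ∀ s p → - + 4 *ℤ (s *ℤ p) ≡ - s *ℤ (+ 4 *ℤ p)
  regroup = solve-∀

expansionTerm : ℕ → ℕ → ℤ
expansionTerm n k = + (suc (2 * n) C (2 * k)) *ℤ (+ T k *ℤ (sgn (n ∸ k) *ℤ + (4 ^ (n ∸ k))))

T≡sumTo-expansionTerm : ∀ n → + T n ≡ sumTo n (expansionTerm n)
T≡sumTo-expansionTerm n = begin
    + T n
  ≡⟨ tan≗tan′⋆sin₂ (suc (2 * n)) ⟩
    (D tan ⋆ sin₂) (suc (2 * n))
  ≡⟨ ⋆-binomial (D tan) sin₂ (suc (2 * n)) ⟩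
    binomialSum (D tan) sin₂ (suc (2 * n))
  ≡⟨ sumTo-pairs n (term) ⟩
    sumTo n (λ k → term (2 * k) +ℤ term (suc (2 * k)))
  ≡⟨ sumTo-cong n (λ k k≤n → trans (cong₂ _+ℤ_ (even k k≤n) (odd k)) (ℤ.+-identityʳ _)) ⟩
    sumTo n (expansionTerm n) ∎
  where
  term : Seq
  term i = + (suc (2 * n) C i) *ℤ (D tan i *ℤ sin₂ (suc (2 * n) ∸ i))

  even : ∀ k → k ≤ n → term (2 * k) ≡ expansionTerm n k
  even k k≤n = cong (λ s → + (suc (2 * n) C (2 * k)) *ℤ (+ T k *ℤ s)) (begin
      sin₂ (suc (2 * n) ∸ 2 * k)
    ≡⟨ cong sin₂ (ℕ.+-∸-assoc 1 (ℕ.*-monoʳ-≤ 2 k≤n)) ⟩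
      sin₂ (suc (2 * n ∸ 2 * k))
    ≡⟨ cong (λ i → sin₂ (suc i)) (sym (ℕ.*-distribˡ-∸ 2 n k)) ⟩
      sin₂ (suc (2 * (n ∸ k)))
    ≡⟨ sin₂-odd (n ∸ k) ⟩
      sgn (n ∸ k) *ℤ + (4 ^ (n ∸ k)) ∎)

  odd : ∀ k → term (suc (2 * k)) ≡ + 0
  odd k = begin
      + c *ℤ (D tan (suc (2 * k)) *ℤ sin₂ (2 * n ∸ 2 * k))
    ≡⟨ cong (λ s → + c *ℤ (D tan (suc (2 * k)) *ℤ s))
            (trans (cong sin₂ (sym (ℕ.*-distribˡ-∸ 2 n k))) (sin₂-even (n ∸ k))) ⟩
      + c *ℤ (D tan (suc (2 * k)) *ℤ + 0)
    ≡⟨ cong (+ c *ℤ_) (ℤ.*-zeroʳ (D tan (suc (2 * k)))) ⟩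
      + c *ℤ + 0
    ≡⟨ ℤ.*-zeroʳ (+ c) ⟩
      + 0 ∎
    where
    c : ℕ
    c = suc (2 * n) C suc (2 * k)

sgn-+ : ∀ m n → sgn (m + n) ≡ sgn m *ℤ sgn n
sgn-+ zero n = sym (ℤ.*-identityˡ (sgn n))
sgn-+ (suc m) n = trans (cong -_ (sgn-+ m n)) (ℤ.neg-distribˡ-* (sgn m) (sgn n))

sgn*sgn≡1 : ∀ n → sgn n *ℤ sgn n ≡ + 1
sgn*sgn≡1 zero = refl
sgn*sgn≡1 (suc n) = trans (neg*neg (sgn n)) (sgn*sgn≡1 n)
  where
  neg*neg : ∀ s → - s *ℤ - s ≡ s *ℤ s
  neg*neg = solve-∀

sgn[n]*sgn[n∸k]≡sgn[k] : k ≤ n → sgn n *ℤ sgn (n ∸ k) ≡ sgn k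
sgn[n]*sgn[n∸k]≡sgn[k] {k} {n} k≤n = begin
    sgn n *ℤ sgn (n ∸ k)
  ≡⟨ cong (λ i → sgn i *ℤ sgn (n ∸ k)) (sym (ℕ.m+[n∸m]≡n k≤n)) ⟩
    sgn (k + (n ∸ k)) *ℤ sgn (n ∸ k)
  ≡⟨ cong (_*ℤ sgn (n ∸ k)) (sgn-+ k (n ∸ k)) ⟩
    sgn k *ℤ sgn (n ∸ k) *ℤ sgn (n ∸ k)
  ≡⟨ ℤ.*-assoc (sgn k) (sgn (n ∸ k)) (sgn (n ∸ k)) ⟩
    sgn k *ℤ (sgn (n ∸ k) *ℤ sgn (n ∸ k))
  ≡⟨ cong (sgn k *ℤ_) (sgn*sgn≡1 (n ∸ k)) ⟩
    sgn k *ℤ + 1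
  ≡⟨ ℤ.*-identityʳ (sgn k) ⟩
    sgn k ∎

signedTerm≡sgn*expansionTerm : k ≤ n →
  sgn k *ℤ (+ (((2 * n + 1) C (2 * k)) * 2 ^ (2 * n ∸ 2 * k) * T k)) ≡ sgn n *ℤ expansionTerm n k
signedTerm≡sgn*expansionTerm {k} {n} k≤n = begin
    sgn k *ℤ (+ (((2 * n + 1) C (2 * k)) * 2 ^ (2 * n ∸ 2 * k) * T k))
  ≡⟨ cong₂ (λ i p → sgn k *ℤ + ((i C (2 * k)) * p * T k)) (ℕ.+-comm (2 * n) 1) 2^[2n∸2k]≡4^[n∸k] ⟩
    sgn k *ℤ + (c * 4 ^ (n ∸ k) * T k)
  ≡⟨ cong (sgn k *ℤ_) (trans (ℤ.pos-* (c * 4 ^ (n ∸ k)) (T k)) (cong (_*ℤ + T k) (ℤ.pos-* c (4 ^ (n ∸ k))))) ⟩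
    sgn k *ℤ (+ c *ℤ + (4 ^ (n ∸ k)) *ℤ + T k)
  ≡⟨ cong (_*ℤ (+ c *ℤ + (4 ^ (n ∸ k)) *ℤ + T k)) (sym (sgn[n]*sgn[n∸k]≡sgn[k] k≤n)) ⟩
    sgn n *ℤ sgn (n ∸ k) *ℤ (+ c *ℤ + (4 ^ (n ∸ k)) *ℤ + T k)
  ≡⟨ regroup (sgn n) (sgn (n ∸ k)) (+ c) (+ (4 ^ (n ∸ k))) (+ T k) ⟩
    sgn n *ℤ expansionTerm n k ∎
  where
  c : ℕ
  c = suc (2 * n) C (2 * k)

  2^[2n∸2k]≡4^[n∸k] : 2 ^ (2 * n ∸ 2 * k) ≡ 4 ^ (n ∸ k)
  2^[2n∸2k]≡4^[n∸k] = trans (cong (2 ^_) (sym (ℕ.*-distribˡ-∸ 2 n k))) (sym (ℕ.^-*-assoc 2 2 (n ∸ k)))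

  regroup : ∀ σₙ σ c p t → σₙ *ℤ σ *ℤ (c *ℤ p *ℤ t) ≡ σₙ *ℤ (c *ℤ (t *ℤ (σ *ℤ p)))
  regroup = solve-∀

mainTheorem3 : ∀ (n : ℕ) →
    sumTo n (λ k → sgn k *ℤ (+ (((2 * n + 1) C (2 * k)) * 2 ^ (2 * n ∸ 2 * k) * T k)))
      ≡ sgn n *ℤ (+ T n)
mainTheorem3 n = begin
    sumTo n (λ k → sgn k *ℤ (+ (((2 * n + 1) C (2 * k)) * 2 ^ (2 * n ∸ 2 * k) * T k)))
  ≡⟨ sumTo-cong n (λ k → signedTerm≡sgn*expansionTerm) ⟩
    sumTo n (sgn n · expansionTerm n)
  ≡⟨ sumTo-· n (sgn n) (expansionTerm n) ⟩
    sgn n *ℤ sumTo n (expansionTerm n)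
  ≡⟨ cong (sgn n *ℤ_) (sym (T≡sumTo-expansionTerm n)) ⟩
    sgn n *ℤ (+ T n) ∎
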